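{- Let $m\ge 2$ and let $a_1,\ldots,a_m$ be distinct nonnegative integers. Set $a_0=a_m$ and $a_{m+1}=a_1$, and let $\alpha=|\{i\in\{1,\ldots,m\}: a_{i-1}<a_i>a_{i+1}\}|$. Then (i) $\sum_{i=1}^m \max\{a_i,a_{i+1}\}\ge \sum_{i=1}^m a_i+\max\{a_1,\ldots,a_m\}-\min\{a_1,\ldots,a_m\}+(\alpha-1)$; (ii) $\sum_{i=0}^{m-1}|a_i-a_{i+1}|\ge 2(m-1)+2(\alpha-1)\ge 2(m-1)$. -}

module Defs where

open import Data.Nat as ℕ using (ℕ; zero; suc; _<_; _⊔_; _⊓_; _∸_)
open import Data.Fin using (Fin; toℕ; fromℕ<)
open import Data.Nat.DivMod using (_%_; m%n<n)
open import Data.Bool using (Bool; true; false; _∧_)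
open import Relation.Nullary.Decidable using (⌊_⌋)
open import Data.Vec.Functional using (Vector; foldr)

-- Cyclic successor and predecessor on Fin m (0-indexed: position i ∈ Fin m
-- stands for the paper's index i+1).  succ i = (i+1) mod m, pred i = (i-1) mod m.
cnext : ∀ {m} .{{_ : ℕ.NonZero m}} → Fin m → Fin m
cnext {m} i = fromℕ< (m%n<n (suc (toℕ i)) m)

cprev : ∀ {m} .{{_ : ℕ.NonZero m}} → Fin m → Fin m
cprev {m} i = fromℕ< (m%n<n (toℕ i ℕ.+ (m ∸ 1)) m)

sumℕ : ∀ {m} → (Fin m → ℕ) → ℕ
sumℕ f = foldr ℕ._+_ 0 f

maxF : ∀ {k} → (Fin (suc k) → ℕ) → ℕ
maxF {zero}  f = f Data.Fin.zero
maxF {suc k} f = f Data.Fin.zero ⊔ maxF (λ i → f (Data.Fin.suc i))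

minF : ∀ {k} → (Fin (suc k) → ℕ) → ℕ
minF {zero}  f = f Data.Fin.zero
minF {suc k} f = f Data.Fin.zero ⊓ minF (λ i → f (Data.Fin.suc i))

count : ∀ {m} → (Fin m → Bool) → ℕ
count {zero}  p = 0
count {suc m} p = (if p Data.Fin.zero then 1 else 0) ℕ.+ count (λ i → p (Data.Fin.suc i))
  where open import Data.Bool using (if_then_else_)

peaks : ∀ {m} .{{_ : ℕ.NonZero m}} → (Fin m → ℕ) → ℕ
peaks a = count (λ i → ⌊ a (cprev i) ℕ.<? a i ⌋ ∧ ⌊ a (cnext i) ℕ.<? a i ⌋)

module Submission where

-- Both follow from one inequality on the total descent D = Σ (aᵢ ∸ aᵢ₊₁),
--   max + (α − 1) ≤ D + min,
-- together with Σ max(aᵢ, aᵢ₊₁) = Σ aᵢ + D, Σ |aᵢ₋₁ − aᵢ| = 2D (ascent equals descent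
-- around a cycle) and max − min ≥ m − 1 (pigeonhole).
-- The descent inequality is proved by cutting the cycle open at the maximum: the
-- resulting path from the maximum back to itself has the other α − 1 peaks as its
-- interior peaks, and along any path g 0, …, g n with distinct neighbours
--   g 0 + (interior peaks) ≤ descent + min g
-- by induction on n.

open import Defs

module Cycles where
  open import Data.Nat
    using (ℕ; zero; suc; _+_; _∸_; _⊔_; _⊓_; _≤_; _<_; z≤n; s≤s; s≤s⁻¹; z<s)
  open import Data.Nat.Properties
  open import Data.Nat.DivMod using (_%_; _mod_; m%n<n; m<n⇒m%n≡m; n%n≡0; %-congˡ; %-distribˡ-+; [m+n]%n≡m%n)
  open import Algebra.Properties.CommutativeSemigroup +-commutativeSemigroup
    using (interchange; x∙yz≈y∙xz; xy∙z≈xz∙y)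
  open import Data.Fin using (Fin; toℕ; fromℕ<)
  import Data.Fin as Fin
  open import Data.Fin.Properties using (toℕ<n; fromℕ<-cong; fromℕ<-toℕ; fromℕ<-injective; injective⇒≤)
  open import Data.Bool using (Bool; if_then_else_; _∧_)
  open import Data.Product using (_×_; _,_; ∃)
  open import Data.Sum using (inj₁; inj₂)
  open import Function using (_∘_)
  open import Function.Definitions using (Injective)
  open import Relation.Binary.Definitions using (tri<; tri≈; tri>)
  open import Relation.Binary.PropositionalEquality
  open import Relation.Nullary using (yes; no; contradiction)
  open import Relation.Nullary.Decidable using (⌊_⌋)

  sumTo : ℕ → (ℕ → ℕ) → ℕ
  sumTo zero    g = 0
  sumTo (suc n) g = g 0 + sumTo n (g ∘ suc)

  sumTo-cong : ∀ n {g h : ℕ → ℕ} → (∀ j → g j ≡ h j) → sumTo n g ≡ sumTo n h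
  sumTo-cong zero    eq = refl
  sumTo-cong (suc n) eq = cong₂ _+_ (eq 0) (sumTo-cong n (eq ∘ suc))

  sumTo-+ : ∀ n (g h : ℕ → ℕ) → sumTo n (λ j → g j + h j) ≡ sumTo n g + sumTo n h
  sumTo-+ zero    g h = refl
  sumTo-+ (suc n) g h =
    trans (cong (g 0 + h 0 +_) (sumTo-+ n (g ∘ suc) (h ∘ suc))) (interchange (g 0) (h 0) _ _)

  sumTo-snoc : ∀ n (g : ℕ → ℕ) → sumTo (suc n) g ≡ sumTo n g + g n
  sumTo-snoc zero    g = +-comm (g 0) 0
  sumTo-snoc (suc n) g = trans (cong (g 0 +_) (sumTo-snoc n (g ∘ suc))) (sym (+-assoc (g 0) _ _))

  Periodic : ℕ → (ℕ → ℕ) → Set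
  Periodic m f = ∀ x → f (m + x) ≡ f x

  periodic-suc : ∀ {m f} → Periodic m f → Periodic m (f ∘ suc)
  periodic-suc {m} {f} per x = trans (cong f (sym (+-suc m x))) (per (suc x))

  periodic-+ʳ : ∀ {m f} → Periodic m f → ∀ d → Periodic m (λ x → f (x + d))
  periodic-+ʳ {m} {f} per d x = trans (cong f (+-assoc m x d)) (per (x + d))

  sumTo-rotate : ∀ m {f} → Periodic m f → sumTo m (f ∘ suc) ≡ sumTo m f
  sumTo-rotate m {f} per = +-cancelʳ-≡ (f 0) _ _ (begin
    sumTo m (f ∘ suc) + f 0  ≡⟨ +-comm _ (f 0) ⟩
    sumTo (suc m) f          ≡⟨ sumTo-snoc m f ⟩
    sumTo m f + f m          ≡⟨ cong (λ t → sumTo m f + f t) (sym (+-identityʳ m)) ⟩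
    sumTo m f + f (m + 0)    ≡⟨ cong (sumTo m f +_) (per 0) ⟩
    sumTo m f + f 0          ∎)
    where open ≡-Reasoning

  sumTo-shift : ∀ m {f} → Periodic m f → ∀ d → sumTo m (λ j → f (j + d)) ≡ sumTo m f
  sumTo-shift m {f} per zero    = sumTo-cong m (λ j → cong f (+-identityʳ j))
  sumTo-shift m {f} per (suc d) = begin
    sumTo m (λ j → f (j + suc d))  ≡⟨ sumTo-cong m (λ j → cong f (+-suc j d)) ⟩
    sumTo m (λ j → f (suc j + d))  ≡⟨ sumTo-rotate m (periodic-+ʳ per d) ⟩
    sumTo m (λ j → f (j + d))      ≡⟨ sumTo-shift m per d ⟩
    sumTo m f                      ∎
    where open ≡-Reasoning

  peak : ℕ → ℕ → ℕ → ℕ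
  peak x y z = if ⌊ x <? y ⌋ ∧ ⌊ z <? y ⌋ then 1 else 0

  peak-top : ∀ {x y z} → x < y → z < y → peak x y z ≡ 1
  peak-top {x} {y} {z} x<y z<y with x <? y | z <? y
  ... | yes _   | yes _   = refl
  ... | yes _   | no z≮y  = contradiction z<y z≮y
  ... | no x≮y  | _       = contradiction x<y x≮y

  peak-descending : ∀ {x y z} → y < x → peak x y z ≡ 0
  peak-descending {x} {y} y<x with x <? y
  ... | yes x<y = contradiction x<y (<⇒≯ y<x)
  ... | no _    = refl

  peak-ascending : ∀ {x y z} → x < y → peak x y z + x ≤ y
  peak-ascending {x} {y} {z} x<y with x <? y | z <? y
  ... | yes _ | yes _ = x<y
  ... | yes _ | no _  = <⇒≤ x<y
  ... | no _  | _     = <⇒≤ x<y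

  peak-below : ∀ {x y z w} → w ≤ y → w ≤ z → peak x y z + w ≤ y
  peak-below {x} {y} {z} w≤y w≤z with x <? y | z <? y
  ... | yes _ | yes z<y = ≤-trans (s≤s w≤z) z<y
  ... | yes _ | no _    = w≤y
  ... | no _  | _       = w≤y

  descent : ℕ → (ℕ → ℕ) → ℕ
  descent n g = sumTo n (λ j → g j ∸ g (suc j))

  -- Peaks at the interior positions 1, …, n − 1.
  interiorPeaks : ℕ → (ℕ → ℕ) → ℕ
  interiorPeaks n g = sumTo (n ∸ 1) (λ j → peak (g j) (g (suc j)) (g (suc (suc j))))

  pathMin : ℕ → (ℕ → ℕ) → ℕ
  pathMin zero    g = g 0
  pathMin (suc n) g = g 0 ⊓ pathMin n (g ∘ suc)

  pathMin-≤ : ∀ n (g : ℕ → ℕ) {j} → j ≤ n → pathMin n g ≤ g j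
  pathMin-≤ zero    g {zero}  _         = ≤-refl
  pathMin-≤ (suc n) g {zero}  _         = m⊓n≤m (g 0) _
  pathMin-≤ (suc n) g {suc j} (s≤s j≤n) = ≤-trans (m⊓n≤n (g 0) _) (pathMin-≤ n (g ∘ suc) j≤n)

  -- Induction step of the path inequality: prepend x to a path starting at y,
  -- creating a possible peak pk at y.  P, D, μ are the interior peaks, descent
  -- and minimum of the old path.
  prepend : ∀ {x y μ P D} pk → x ≢ y → pk + μ ≤ y →
            (x < y → pk + x ≤ y) → (y < x → pk ≡ 0) →
            y + P ≤ D + μ → x + (pk + P) ≤ (x ∸ y + D) + (x ⊓ μ)
  prepend {x} {y} {μ} {P} {D} pk x≢y pk+μ≤y ascending descending ih with <-cmp x y
  ... | tri≈ _ x≡y _ = contradiction x≡y x≢y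
  ... | tri< x<y _ _ = begin
    x + (pk + P)       ≤⟨ ⊓-glb via-x via-μ ⟩
    (D + x) ⊓ (D + μ)  ≡⟨ +-distribˡ-⊓ D x μ ⟨
    D + (x ⊓ μ)        ≡⟨ cong (λ t → t + D + (x ⊓ μ)) (m≤n⇒m∸n≡0 (<⇒≤ x<y)) ⟨
    x ∸ y + D + (x ⊓ μ) ∎
    where
    open ≤-Reasoning
    pk+P≤D : pk + P ≤ D
    pk+P≤D = +-cancelʳ-≤ μ _ _ (begin
      pk + P + μ  ≡⟨ xy∙z≈xz∙y pk P μ ⟩
      pk + μ + P  ≤⟨ +-monoˡ-≤ P pk+μ≤y ⟩
      y + P       ≤⟨ ih ⟩
      D + μ       ∎)
    via-x : x + (pk + P) ≤ D + x
    via-x = ≤-trans (+-monoʳ-≤ x pk+P≤D) (≤-reflexive (+-comm x D))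
    via-μ : x + (pk + P) ≤ D + μ
    via-μ = begin
      x + (pk + P)  ≡⟨ x∙yz≈y∙xz x pk P ⟩
      pk + (x + P)  ≡⟨ +-assoc pk x P ⟨
      pk + x + P    ≤⟨ +-monoˡ-≤ P (ascending x<y) ⟩
      y + P         ≤⟨ ih ⟩
      D + μ         ∎
  ... | tri> _ _ y<x = begin
    x + (pk + P)         ≡⟨ cong (λ t → x + (t + P)) (descending y<x) ⟩
    x + P                ≡⟨ cong (_+ P) (m∸n+n≡m (<⇒≤ y<x)) ⟨
    x ∸ y + y + P        ≡⟨ +-assoc (x ∸ y) y P ⟩
    x ∸ y + (y + P)      ≤⟨ +-monoʳ-≤ (x ∸ y) ih ⟩
    x ∸ y + (D + μ)      ≡⟨ +-assoc (x ∸ y) D μ ⟨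
    x ∸ y + D + μ        ≡⟨ cong (x ∸ y + D +_) (m≥n⇒m⊓n≡n μ≤x) ⟨
    x ∸ y + D + (x ⊓ μ)  ∎
    where
    open ≤-Reasoning
    μ≤x : μ ≤ x
    μ≤x = ≤-trans (m≤n+m μ pk) (≤-trans pk+μ≤y (<⇒≤ y<x))

  descent-pays : ∀ n (g : ℕ → ℕ) → (∀ j → j < n → g j ≢ g (suc j)) →
                 g 0 + interiorPeaks n g ≤ descent n g + pathMin n g
  descent-pays zero          g adjacent = ≤-reflexive (+-comm (g 0) 0)
  descent-pays (suc zero)    g adjacent =
    prepend 0 (adjacent 0 z<s) ≤-refl <⇒≤ (λ _ → refl) (descent-pays zero (g ∘ suc) λ _ ())
  descent-pays (suc (suc n)) g adjacent =
    prepend (peak (g 0) (g 1) (g 2)) (adjacent 0 z<s)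
      (peak-below (pathMin-≤ (suc n) (g ∘ suc) z≤n) (pathMin-≤ (suc n) (g ∘ suc) (s≤s z≤n)))
      peak-ascending peak-descending
      (descent-pays (suc n) (g ∘ suc) (λ j j<n → adjacent (suc j) (s≤s j<n)))

  ⊔≡+∸ : ∀ x y → x ⊔ y ≡ y + (x ∸ y)
  ⊔≡+∸ x y with ≤-total x y
  ... | inj₁ x≤y = trans (m≤n⇒m⊔n≡n x≤y) (sym (trans (cong (y +_) (m≤n⇒m∸n≡0 x≤y)) (+-identityʳ y)))
  ... | inj₂ y≤x = trans (m≥n⇒m⊔n≡m y≤x) (sym (m+[n∸m]≡n y≤x))

  -- Cyclic sequences: b periodic with period suc n, read as b 0, …, b n
  -- arranged on a cycle (the predecessor of position j is j + n).

  module Cyclic (n : ℕ) (b : ℕ → ℕ) (periodic : Periodic (suc n) b) where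

    wrap : ∀ i → b (suc (i + n)) ≡ b i
    wrap i = trans (cong (b ∘ suc) (+-comm i n)) (periodic i)

    cyclicDescent : ℕ
    cyclicDescent = sumTo (suc n) (λ j → b j ∸ b (suc j))

    cyclicPeaks : ℕ
    cyclicPeaks = sumTo (suc n) (λ j → peak (b (j + n)) (b j) (b (suc j)))

    private
      neighbours-periodic : (h : ℕ → ℕ → ℕ) → Periodic (suc n) (λ j → h (b j) (b (suc j)))
      neighbours-periodic h x = cong₂ h (periodic x) (periodic-suc periodic x)

      peakTerm-periodic : Periodic (suc n) (λ j → peak (b (j + n)) (b j) (b (suc j)))
      peakTerm-periodic x = trans
        (cong₂ (λ u v → peak u v (b (suc (suc n + x)))) (periodic-+ʳ periodic n x) (periodic x))
        (cong (peak (b (x + n)) (b x)) (periodic-suc periodic x))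

    sum-max : sumTo (suc n) (λ j → b j ⊔ b (suc j)) ≡ sumTo (suc n) b + cyclicDescent
    sum-max = begin
      sumTo (suc n) (λ j → b j ⊔ b (suc j))                  ≡⟨ sumTo-cong (suc n) (λ j → ⊔≡+∸ (b j) (b (suc j))) ⟩
      sumTo (suc n) (λ j → b (suc j) + (b j ∸ b (suc j)))    ≡⟨ sumTo-+ (suc n) (b ∘ suc) (λ j → b j ∸ b (suc j)) ⟩
      sumTo (suc n) (b ∘ suc) + cyclicDescent                ≡⟨ cong (_+ cyclicDescent) (sumTo-rotate (suc n) periodic) ⟩
      sumTo (suc n) b + cyclicDescent                        ∎
      where open ≡-Reasoning

    ascent≡descent : sumTo (suc n) (λ j → b (suc j) ∸ b j) ≡ cyclicDescent
    ascent≡descent = +-cancelˡ-≡ (sumTo (suc n) b) _ _ (begin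
      sumTo (suc n) b + sumTo (suc n) (λ j → b (suc j) ∸ b j)  ≡⟨ sumTo-+ (suc n) b (λ j → b (suc j) ∸ b j) ⟨
      sumTo (suc n) (λ j → b j + (b (suc j) ∸ b j))            ≡⟨ sumTo-cong (suc n) (λ j → ⊔≡+∸ (b (suc j)) (b j)) ⟨
      sumTo (suc n) (λ j → b (suc j) ⊔ b j)                    ≡⟨ sumTo-cong (suc n) (λ j → ⊔-comm (b (suc j)) (b j)) ⟩
      sumTo (suc n) (λ j → b j ⊔ b (suc j))                    ≡⟨ sum-max ⟩
      sumTo (suc n) b + cyclicDescent                          ∎)
      where open ≡-Reasoning

    variation : sumTo (suc n) (λ j → (b (j + n) ∸ b j) + (b j ∸ b (j + n)))
                ≡ cyclicDescent + cyclicDescent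
    variation = begin
      sumTo (suc n) (λ j → (b (j + n) ∸ b j) + (b j ∸ b (j + n)))  ≡⟨ sumTo-cong (suc n) (λ j → cong (λ t → dist (b (j + n)) t) (sym (wrap j))) ⟩
      sumTo (suc n) (λ j → dist (b (j + n)) (b (suc (j + n))))     ≡⟨ sumTo-shift (suc n) (neighbours-periodic dist) n ⟩
      sumTo (suc n) (λ j → dist (b j) (b (suc j)))                 ≡⟨ sumTo-+ (suc n) (λ j → b j ∸ b (suc j)) (λ j → b (suc j) ∸ b j) ⟩
      cyclicDescent + sumTo (suc n) (λ j → b (suc j) ∸ b j)        ≡⟨ cong (cyclicDescent +_) ascent≡descent ⟩
      cyclicDescent + cyclicDescent                                ∎
      where
      open ≡-Reasoning
      dist : ℕ → ℕ → ℕ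
      dist x y = (x ∸ y) + (y ∸ x)

    peaks-bound : (∀ j → b j ≢ b (suc j)) → ∀ {p q} → p < suc n → q < suc n →
                  (∀ j → b j ≤ b p) →
                  ∃ λ β → cyclicPeaks ≡ suc β × b p + β ≤ cyclicDescent + b q
    peaks-bound adjacent {p} {q} p<m q<m maximal =
      interiorPeaks (suc n) c , peaks-split , (begin
        b p + interiorPeaks (suc n) c          ≤⟨ descent-pays (suc n) c (λ j _ → adjacent (j + p)) ⟩
        descent (suc n) c + pathMin (suc n) c  ≤⟨ +-mono-≤ (≤-reflexive descent-rotated) min≤b-q ⟩
        cyclicDescent + b q                    ∎)
      where
      open ≤-Reasoning
      -- the cycle cut open at the maximum: a path from b p back to b p
      c : ℕ → ℕ
      c j = b (j + p)

      descent-rotated : descent (suc n) c ≡ cyclicDescent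
      descent-rotated = sumTo-shift (suc n) (neighbours-periodic _∸_) p

      peak-at-max : peak (b (p + n)) (b p) (b (suc p)) ≡ 1
      peak-at-max = peak-top
        (≤∧≢⇒< (maximal (p + n)) (λ e → adjacent (p + n) (trans e (sym (wrap p)))))
        (≤∧≢⇒< (maximal (suc p)) (λ e → adjacent p (sym e)))

      peaks-split : cyclicPeaks ≡ suc (interiorPeaks (suc n) c)
      peaks-split = trans (sym (sumTo-shift (suc n) peakTerm-periodic p))
        (cong₂ _+_ peak-at-max (sumTo-cong n (λ j → cong (λ t → peak t (c (suc j)) (c (suc (suc j)))) (wrap (j + p)))))

      -- q is reached on the path, either q − p or (suc n + q) − p steps after p
      min≤b-q : pathMin (suc n) c ≤ b q
      min≤b-q with p ≤? q
      ... | yes p≤q = ≤-trans (pathMin-≤ (suc n) c (≤-trans (m∸n≤m q p) (<⇒≤ q<m)))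
                              (≤-reflexive (cong b (m∸n+n≡m p≤q)))
      ... | no p≰q = ≤-trans (pathMin-≤ (suc n) c steps≤)
                             (≤-reflexive (trans (cong b (m∸n+n≡m p≤m+q)) (periodic q)))
        where
        p≤m+q : p ≤ suc n + q
        p≤m+q = ≤-trans (<⇒≤ p<m) (m≤m+n (suc n) q)
        steps≤ : suc n + q ∸ p ≤ suc n
        steps≤ = ≤-trans (∸-monoʳ-≤ (suc n + q) (<⇒≤ (≰⇒> p≰q))) (≤-reflexive (m+n∸n≡m (suc n) q))

  sumℕ-sumTo : ∀ {n} (f : Fin n → ℕ) (g : ℕ → ℕ) → (∀ i → f i ≡ g (toℕ i)) → sumℕ f ≡ sumTo n g
  sumℕ-sumTo {zero}  f g eq = refl
  sumℕ-sumTo {suc n} f g eq = cong₂ _+_ (eq Fin.zero) (sumℕ-sumTo (f ∘ Fin.suc) (g ∘ suc) (eq ∘ Fin.suc))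

  count-as-sum : ∀ {n} (p : Fin n → Bool) → count p ≡ sumℕ (λ i → if p i then 1 else 0)
  count-as-sum {zero}  p = refl
  count-as-sum {suc n} p = cong ((if p Fin.zero then 1 else 0) +_) (count-as-sum (p ∘ Fin.suc))

  %-suc-≢ : ∀ k j → j % suc (suc k) ≢ suc j % suc (suc k)
  %-suc-≢ k j eq = r≢[1+r]%m (m%n<n j m) (trans eq (%-distribˡ-+ 1 j m))
    where
    m : ℕ
    m = suc (suc k)
    r≢[1+r]%m : ∀ {r} → r < m → r ≢ suc r % m
    r≢[1+r]%m {r} r<m r≡ with m≤n⇒m<n∨m≡n r<m
    ... | inj₁ 1+r<m = 1+n≢n (sym (trans r≡ (m<n⇒m%n≡m 1+r<m)))
    ... | inj₂ 1+r≡m = 0≢1+n (trans (sym r≡0) (suc-injective 1+r≡m))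
      where
      r≡0 : r ≡ 0
      r≡0 = trans r≡ (trans (%-congˡ {o = m} 1+r≡m) (n%n≡0 m))

  module Extension {n : ℕ} (a : Fin (suc n) → ℕ) where

    -- The periodic extension j ↦ a (j mod (n + 1)); by definition
    -- a (cnext i) = ext (1 + i) and a (cprev i) = ext (i + n).
    ext : ℕ → ℕ
    ext j = a (j mod suc n)

    ext-toℕ : ∀ i → ext (toℕ i) ≡ a i
    ext-toℕ i = cong a (trans (fromℕ<-cong _ _ (m<n⇒m%n≡m (toℕ<n i)) _ (toℕ<n i)) (fromℕ<-toℕ i _))

    ext-periodic : Periodic (suc n) ext
    ext-periodic x = cong a (fromℕ<-cong _ _ (trans (%-congˡ (+-comm (suc n) x)) ([m+n]%n≡m%n x (suc n))) _ _)

  maxF-upper : ∀ {k} (f : Fin (suc k) → ℕ) i → f i ≤ maxF f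
  maxF-upper {zero}  f Fin.zero    = ≤-refl
  maxF-upper {suc k} f Fin.zero    = m≤m⊔n _ _
  maxF-upper {suc k} f (Fin.suc i) = ≤-trans (maxF-upper (f ∘ Fin.suc) i) (m≤n⊔m _ _)

  maxF-attained : ∀ {k} (f : Fin (suc k) → ℕ) → ∃ λ i → f i ≡ maxF f
  maxF-attained {zero}  f = Fin.zero , refl
  maxF-attained {suc k} f with ⊔-sel (f Fin.zero) (maxF (f ∘ Fin.suc)) | maxF-attained (f ∘ Fin.suc)
  ... | inj₁ e | _       = Fin.zero , sym e
  ... | inj₂ e | i , fi≡ = Fin.suc i , trans fi≡ (sym e)

  minF-lower : ∀ {k} (f : Fin (suc k) → ℕ) i → minF f ≤ f i
  minF-lower {zero}  f Fin.zero    = ≤-refl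
  minF-lower {suc k} f Fin.zero    = m⊓n≤m _ _
  minF-lower {suc k} f (Fin.suc i) = ≤-trans (m⊓n≤n _ _) (minF-lower (f ∘ Fin.suc) i)

  minF-attained : ∀ {k} (f : Fin (suc k) → ℕ) → ∃ λ i → f i ≡ minF f
  minF-attained {zero}  f = Fin.zero , refl
  minF-attained {suc k} f with ⊓-sel (f Fin.zero) (minF (f ∘ Fin.suc)) | minF-attained (f ∘ Fin.suc)
  ... | inj₁ e | _       = Fin.zero , sym e
  ... | inj₂ e | i , fi≡ = Fin.suc i , trans fi≡ (sym e)

  -- n + 1 distinct naturals span a range of length at least n: shifting by the
  -- minimum embeds them injectively into Fin (max − min + 1).
  spread : ∀ {n} (a : Fin (suc n) → ℕ) → Injective _≡_ _≡_ a → n + minF a ≤ maxF a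
  spread {n} a inj = begin
    n + minF a              ≤⟨ +-monoˡ-≤ (minF a) (s≤s⁻¹ (injective⇒≤ shifted-injective)) ⟩
    maxF a ∸ minF a + minF a ≡⟨ m∸n+n≡m (≤-trans (minF-lower a Fin.zero) (maxF-upper a Fin.zero)) ⟩
    maxF a                  ∎
    where
    open ≤-Reasoning
    shifted : Fin (suc n) → Fin (suc (maxF a ∸ minF a))
    shifted i = fromℕ< (s≤s (∸-monoˡ-≤ (minF a) (maxF-upper a i)))
    shifted-injective : Injective _≡_ _≡_ shifted
    shifted-injective e =
      inj (∸-cancelʳ-≡ (minF-lower a _) (minF-lower a _) (fromℕ<-injective _ _ _ _ e))

  module Arrangement (k : ℕ) (a : Fin (suc (suc k)) → ℕ) (inj : Injective _≡_ _≡_ a) where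

    open Extension a public
    open Cyclic (suc k) ext ext-periodic public

    -- Distinct entries make cyclic neighbours distinct (here m ≥ 2 is used).
    ext-adjacent : ∀ j → ext j ≢ ext (suc j)
    ext-adjacent j e = %-suc-≢ k j (fromℕ<-injective _ _ _ _ (inj e))

    sum-a : sumℕ a ≡ sumTo (suc (suc k)) ext
    sum-a = sumℕ-sumTo a ext (sym ∘ ext-toℕ)

    sum-max-a : sumℕ (λ i → a i ⊔ a (cnext i)) ≡ sumℕ a + cyclicDescent
    sum-max-a = begin
      sumℕ (λ i → a i ⊔ a (cnext i))                    ≡⟨ sumℕ-sumTo _ (λ j → ext j ⊔ ext (suc j)) (λ i → cong (_⊔ a (cnext i)) (sym (ext-toℕ i))) ⟩
      sumTo (suc (suc k)) (λ j → ext j ⊔ ext (suc j))   ≡⟨ sum-max ⟩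
      sumTo (suc (suc k)) ext + cyclicDescent           ≡⟨ cong (_+ cyclicDescent) sum-a ⟨
      sumℕ a + cyclicDescent                            ∎
      where open ≡-Reasoning

    peaks≡cyclicPeaks : peaks a ≡ cyclicPeaks
    peaks≡cyclicPeaks = trans (count-as-sum (λ i → ⌊ a (cprev i) <? a i ⌋ ∧ ⌊ a (cnext i) <? a i ⌋))
      (sumℕ-sumTo _ (λ j → peak (ext (j + suc k)) (ext j) (ext (suc j))) (λ i → cong (λ t → peak (a (cprev i)) t (a (cnext i))) (sym (ext-toℕ i))))

    descent-bound : ∃ λ β → peaks a ≡ suc β × maxF a + β ≤ cyclicDescent + minF a
    descent-bound =
      let p , ap≡max = maxF-attained a
          q , aq≡min = minF-attained a
          maximal : ∀ j → ext j ≤ ext (toℕ p)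
          maximal j = ≤-trans (maxF-upper a _) (≤-reflexive (sym (trans (ext-toℕ p) ap≡max)))
          β , α≡1+β , bound = peaks-bound ext-adjacent (toℕ<n p) (toℕ<n q) maximal
      in β , trans peaks≡cyclicPeaks α≡1+β
           , subst₂ (λ M L → M + β ≤ cyclicDescent + L) (trans (ext-toℕ p) ap≡max) (trans (ext-toℕ q) aq≡min) bound

    max-sum-bound : ∀ {β} → maxF a + β ≤ cyclicDescent + minF a →
                    sumℕ a + maxF a + β ≤ sumℕ (λ i → a i ⊔ a (cnext i)) + minF a
    max-sum-bound {β} bound = begin
      sumℕ a + maxF a + β                   ≡⟨ +-assoc (sumℕ a) (maxF a) β ⟩
      sumℕ a + (maxF a + β)                 ≤⟨ +-monoʳ-≤ (sumℕ a) bound ⟩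
      sumℕ a + (cyclicDescent + minF a)     ≡⟨ +-assoc (sumℕ a) cyclicDescent (minF a) ⟨
      sumℕ a + cyclicDescent + minF a       ≡⟨ cong (_+ minF a) sum-max-a ⟨
      sumℕ (λ i → a i ⊔ a (cnext i)) + minF a ∎
      where open ≤-Reasoning

    descent-lower-bound : ∀ {β} → maxF a + β ≤ cyclicDescent + minF a → suc k + β ≤ cyclicDescent
    descent-lower-bound {β} bound = +-cancelʳ-≤ (minF a) _ _ (begin
      suc k + β + minF a      ≡⟨ xy∙z≈xz∙y (suc k) β (minF a) ⟩
      suc k + minF a + β      ≤⟨ +-monoˡ-≤ β (spread a inj) ⟩
      maxF a + β              ≤⟨ bound ⟩
      cyclicDescent + minF a  ∎)
      where open ≤-Reasoning

open Cycles
open import Data.Nat as ℕ using (ℕ; suc; _⊔_; _∸_)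
import Data.Nat.Properties as ℕ
open import Data.Fin using (Fin)
open import Data.Integer using (+_; -_; _-_; _+_; _*_; _≤_; ∣_∣; _⊖_; +≤+)
open import Data.Integer.Properties using (pos-*; +-monoˡ-≤; *-distribˡ-+; i≤i+j; m-n≡m⊖n; ∣⊖∣-≤; ∣m⊖n∣≡∣n⊖m∣; ≤-trans; ≤-reflexive; module ≤-Reasoning)
open import Data.Integer.Tactic.RingSolver using (solve-∀)
open import Data.Product using (_×_; _,_)
open import Data.Sum using (inj₁; inj₂)
open import Function.Definitions using (Injective)
open import Relation.Binary.PropositionalEquality using (_≡_; sym; trans; cong; subst; module ≡-Reasoning)

∣+x-+y∣ : ∀ x y → ∣ + x - + y ∣ ≡ (x ∸ y) ℕ.+ (y ∸ x)
∣+x-+y∣ x y with ℕ.≤-total x y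
... | inj₁ x≤y = begin
  ∣ + x - + y ∣        ≡⟨ cong ∣_∣ (m-n≡m⊖n x y) ⟩
  ∣ x ⊖ y ∣            ≡⟨ ∣⊖∣-≤ x≤y ⟩
  y ∸ x                ≡⟨ cong (ℕ._+ (y ∸ x)) (ℕ.m≤n⇒m∸n≡0 x≤y) ⟨
  (x ∸ y) ℕ.+ (y ∸ x)  ∎
  where open ≡-Reasoning
... | inj₂ y≤x = begin
  ∣ + x - + y ∣        ≡⟨ cong ∣_∣ (m-n≡m⊖n x y) ⟩
  ∣ x ⊖ y ∣            ≡⟨ ∣m⊖n∣≡∣n⊖m∣ x y ⟩
  ∣ y ⊖ x ∣            ≡⟨ ∣⊖∣-≤ y≤x ⟩
  x ∸ y                ≡⟨ ℕ.+-identityʳ (x ∸ y) ⟨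
  (x ∸ y) ℕ.+ 0        ≡⟨ cong ((x ∸ y) ℕ.+_) (ℕ.m≤n⇒m∸n≡0 y≤x) ⟨
  (x ∸ y) ℕ.+ (y ∸ x)  ∎
  where open ≡-Reasoning

sub-≤ : ∀ {x y z} → x ℕ.≤ y ℕ.+ z → + x - + z ≤ + y
sub-≤ {x} {y} {z} x≤y+z = begin
  + x - + z            ≤⟨ +-monoˡ-≤ (- + z) (+≤+ x≤y+z) ⟩
  + y + + z - + z      ≡⟨ cancel (+ y) (+ z) ⟩
  + y                  ∎
  where
  open ≤-Reasoning
  cancel : ∀ i j → i + j - j ≡ i
  cancel = solve-∀

twice-≤ : ∀ {x y d} → x ℕ.+ y ℕ.≤ d → + 2 * + x + + 2 * + y ≤ + (d ℕ.+ d)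
twice-≤ {x} {y} {d} x+y≤d = begin
  + 2 * + x + + 2 * + y  ≡⟨ *-distribˡ-+ (+ 2) (+ x) (+ y) ⟨
  + 2 * + (x ℕ.+ y)      ≡⟨ pos-* 2 (x ℕ.+ y) ⟨
  + (2 ℕ.* (x ℕ.+ y))    ≤⟨ +≤+ (ℕ.*-monoʳ-≤ 2 x+y≤d) ⟩
  + (2 ℕ.* d)            ≡⟨ cong (λ t → + (d ℕ.+ t)) (ℕ.+-identityʳ d) ⟩
  + (d ℕ.+ d)            ∎
  where open ≤-Reasoning

module _ (k : ℕ) (a : Fin (suc (suc k)) → ℕ) (inj : Injective _≡_ _≡_ a) where

  open Arrangement k a inj

  total-variation : sumℕ (λ i → ∣ + a (cprev i) - + a i ∣) ≡ cyclicDescent ℕ.+ cyclicDescent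
  total-variation = trans
    (sumℕ-sumTo (λ i → ∣ + a (cprev i) - + a i ∣) (λ j → (ext (j ℕ.+ suc k) ∸ ext j) ℕ.+ (ext j ∸ ext (j ℕ.+ suc k)))
      (λ i → trans (∣+x-+y∣ (a (cprev i)) (a i)) (cong (λ t → (a (cprev i) ∸ t) ℕ.+ (t ∸ a (cprev i))) (sym (ext-toℕ i)))))
    variation

-- With α = 1 + β peaks, the descent inequality  max + β ≤ D + min  gives
-- (i) via Σ max(aᵢ, aᵢ₊₁) = Σ aᵢ + D, and (ii) via Σ |aᵢ₋₁ − aᵢ| = 2D and
-- max − min ≥ m − 1; (iii) is β ≥ 0.  After rewriting α to 1 + β, the integer
-- α − 1 computes to β.
lemma5p1 : (k : ℕ) → (a : Fin (suc (suc k)) → ℕ) → Injective _≡_ _≡_ a →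
    ((+ sumℕ a) + (+ maxF a) - (+ minF a) + ((+ peaks a) - + 1)
        ≤ + sumℕ (λ i → a i ⊔ a (cnext i)))
    × ((+ 2) * (+ suc k) + (+ 2) * ((+ peaks a) - + 1)
        ≤ + sumℕ (λ i → ∣ (+ a (cprev i)) - (+ a i) ∣))
    × ((+ 2) * (+ suc k) ≤ (+ 2) * (+ suc k) + (+ 2) * ((+ peaks a) - + 1))
lemma5p1 k a inj with Arrangement.descent-bound k a inj
... | β , α≡1+β , bound rewrite α≡1+β =
      ≤-trans (≤-reflexive (reorder (+ sumℕ a) (+ maxF a) (+ minF a) (+ β))) (sub-≤ (max-sum-bound bound))
    , ≤-trans (twice-≤ {suc k} {β} (descent-lower-bound bound)) (≤-reflexive (cong +_ (sym (total-variation k a inj))))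
    , subst (λ t → + 2 * + suc k ≤ + 2 * + suc k + t) (pos-* 2 β) (i≤i+j (+ 2 * + suc k) (+ (2 ℕ.* β)))
  where
  open Arrangement k a inj
  reorder : ∀ s M L b → s + M - L + b ≡ s + M + b - L
  reorder = solve-∀
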